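{- Let $d$ be a power of $2$. For every $n$ and every function $H:\{0,1\}^{2n}\to\{0,1\}$, the function $F_H:\{0,1\}^{2n}\to\{0,1\}$ defined below satisfies $\gamma_{2d,2}(F_H)\ge\frac34-o(1)$, where $o(1)$ tends to $0$ as $n\to\infty$ (independently of $H$). Here, writing the inputs as $(x,y)$ with $x,y\in\{0,1\}^n$, $$F_H(x,y)=\begin{cases}0 & \text{if } \binom{|x|}{d}\binom{|y|}{d}\equiv 0 \pmod 4,\\ 1 & \text{if } \binom{|x|}{d}\binom{|y|}{d}\equiv 2 \pmod 4,\\ H(x,y) & \text{otherwise.}\end{cases}$$
   Context: $|x|$ is the Hamming weight. For a Boolean function $F:\{0,1\}^m\to\{0,1\}$ and $k\ge 1$, its $k$-lift is $F_k:\{0,1\}^m\to \mathbb{Z}/2^k\mathbb{Z}$ with $F_k=0$ where $F=0$ and $F_k=2^{k-1}$ where $F=1$. $\mathcal{P}_{d,k}$ is the set of multilinear polynomials in the $m$ input variables of degree at most $d$ with coefficients in $\mathbb{Z}/2^k\mathbb{Z}$. $\mathrm{agr}(F,G)=\Pr[F=G]$ under the uniform distribution, and $\gamma_{d,k}(F)=\max_{Q\in\mathcal{P}_{d,k}}\mathrm{agr}(F_k,Q)$. -}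

module Defs where

open import Data.Bool using (Bool; true; false; if_then_else_)
open import Data.Nat using (ℕ; zero; suc; _+_; _*_; _∸_; _^_; _≤_; _<_; _≟_; _%_)
open import Data.Nat.Properties using (m^n≢0)
open import Data.Nat.Combinatorics using (_C_)
open import Data.Fin using (Fin; toℕ)
open import Data.Vec using (Vec; []; _∷_; splitAt)
open import Data.List using (List; []; _∷_; map; _++_; filter; length; foldr)
open import Data.Product using (_×_; _,_; proj₁; proj₂)
open import Relation.Binary.PropositionalEquality using (_≡_)
open import Data.Integer using (+_)
open import Data.Rational using (ℚ; _/_)

Cube : ℕ → Set
Cube m = Vec Bool m

allCube : (m : ℕ) → List (Cube m)
allCube zero    = [] ∷ []
allCube (suc m) = map (false ∷_) (allCube m) ++ map (true ∷_) (allCube m)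

b2n : Bool → ℕ
b2n true  = 1
b2n false = 0

weight : ∀ {m} → Cube m → ℕ
weight []       = 0
weight (b ∷ bs) = b2n b + weight bs

-- Multilinear monomial x^S = ∏_{i ∈ S} x_i, with S ⊆ [m] given by its indicator vector.
monomial : ∀ {m} → Cube m → Cube m → ℕ
monomial []          []       = 1
monomial (false ∷ S) (_ ∷ x)  = monomial S x
monomial (true ∷ S)  (b ∷ x)  = b2n b * monomial S x

-- 𝒫_{d,k}: multilinear polynomials in m variables of degree ≤ d with
-- coefficients in ℤ/2^kℤ (represented as Fin (2^k)); one coefficient per
-- subset S of variables, vanishing when |S| > d.
record Poly (m d k : ℕ) : Set where
  field
    coeff : Cube m → Fin (2 ^ k)
    deg   : ∀ S → d < weight S → toℕ (coeff S) ≡ 0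
open Poly public

eval : ∀ {m d k} → Poly m d k → Cube m → ℕ
eval {m} {k = k} Q x =
  (foldr _+_ 0 (map (λ S → toℕ (coeff Q S) * monomial S x) (allCube m)))
    % (2 ^ k) where instance _ = m^n≢0 2 k

lift : ∀ {m} (k : ℕ) → (Cube m → Bool) → Cube m → ℕ
lift k F x = if F x then 2 ^ (k ∸ 1) else 0

agreeCount : ∀ {m d k} → (Cube m → Bool) → Poly m d k → ℕ
agreeCount {m} {k = k} F Q =
  length (filter (λ x → lift k F x ≟ eval Q x) (allCube m))

agr : ∀ {m d k} → (Cube m → Bool) → Poly m d k → ℚ
agr {m} F Q = (+ agreeCount F Q) / (2 ^ m)
  where instance _ = m^n≢0 2 m

FH : (n d : ℕ) → (Cube (n + n) → Bool) → Cube (n + n) → Bool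
FH n d H z with splitAt n z
... | x , y , _ with ((weight x C d) * (weight y C d)) % 4
...   | 0 = false
...   | 2 = true
...   | _ = H z

-- Let d = 2^j and Q(x, y) = e_d(x) e_d(y) over ℤ/4, where e_d is the d-th elementary symmetric
-- polynomial; Q has degree 2d and Q(x, y) ≡ C(|x|,d) C(|y|,d) (mod 4). Wherever that product is
-- even it is 0 or 2 mod 4, which is exactly the 2-lift of F_H, so Q can only disagree with F_H
-- where both C(|x|,d) and C(|y|,d) are odd. Since (1 + X)^(w+d) ≡ (1 + X)^w (1 + X^d) (mod 2),
-- the parity of C(w,d) flips when w grows by d. Grouping the cube {0,1}^n into d-dimensional
-- subcubes, this antiperiodicity forces the proportion of x with C(|x|,d) odd to be
-- 1/2 + O((1 - 2^(1-d))^(n/d)); hence Q disagrees with F_H on at most (1/4 + o(1)) 4^n points.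

module Submission where

open import Defs
open import Data.Bool using (Bool; true; false; if_then_else_; _∧_; T)
open import Data.Bool.Properties using (T-∧)
open import Data.Empty using (⊥-elim)
open import Data.Fin using (Fin; toℕ) renaming (zero to fzero; suc to fsuc)
open import Data.Integer using (+_; +[1+_]; -[1+_])
import Data.Integer as ℤ
import Data.Integer.Properties as ℤ
open import Data.List using (List; []; _∷_; map; filter; length)
open import Data.List.Properties using (map-++; map-∘; map-cong)
open import Data.Nat using (ℕ; zero; suc; pred; NonZero; _+_; _*_; _∸_; _^_; _≤_; _<_; _%_; z≤n; s≤s; _≡ᵇ_; _≟_)
import Data.Nat as ℕ
open import Data.Nat.Combinatorics using (_C_; nCk+nC[k+1]≡[n+1]C[k+1])
open import Data.Nat.Coprimality using (Coprime)
open import Data.Nat.Divisibility using (divides)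
open import Data.Nat.DivMod using (m≡m%n+[m/n]*n; m*n/n≡m; /-monoˡ-≤; m%n<n; m<n⇒m%n≡m)
open import Data.Nat.DivMod using (%-distribˡ-*; %-distribˡ-+; [m+kn]%n≡m%n; m∣n⇒o%n%m≡o%m)
open import Data.Nat.ListAction using (sum)
open import Data.Nat.ListAction.Properties using (sum-++)
open import Data.Nat.Properties
open import Data.Nat.Tactic.RingSolver using (solve-∀)
open import Algebra.Properties.CommutativeSemigroup +-commutativeSemigroup using () renaming (interchange to +-interchange)
open import Algebra.Properties.CommutativeSemigroup *-commutativeSemigroup using ()
  renaming (interchange to *-interchange; x∙yz≈y∙xz to *-left-comm)
open import Data.Product using (_×_; _,_; proj₁; proj₂; ∃-syntax)
open import Data.Rational using (ℚ; mkℚ; toℚᵘ; _/_; _-_; _>_; 0ℚ; *<*) renaming (_≤_ to _≤ℚ_)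
import Data.Rational as ℚ
import Data.Rational.Properties as ℚ
open import Data.Rational.Unnormalised using (mkℚᵘ; *≤*)
import Data.Rational.Unnormalised as ℚᵘ
import Data.Rational.Unnormalised.Properties as ℚᵘ
open import Data.Vec using (Vec; []; _∷_; splitAt; _++_)
open import Function using (_∘_)
open import Function.Bundles using (Equivalence)
open import Level using (0ℓ)
open import Relation.Binary.Bundles using (Setoid)
open import Relation.Binary.PropositionalEquality
import Relation.Binary.Reasoning.Setoid as SetoidReasoning
open import Relation.Nullary using (does; contradiction)
open import Relation.Nullary.Decidable using (dec-true)
open import Relation.Unary using (Pred; Decidable)

∑ : {A : Set} → List A → (A → ℕ) → ℕ
∑ xs f = sum (map f xs)

syntax ∑ xs (λ x → e) = ∑[ x ∈ xs ] e

module _ {A : Set} where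

  ∑-++ : ∀ (xs ys : List A) f → ∑ (xs Data.List.++ ys) f ≡ ∑ xs f + ∑ ys f
  ∑-++ xs ys f = trans (cong sum (map-++ f xs ys)) (sum-++ (map f xs) (map f ys))

  ∑-cong : ∀ (xs : List A) {f g : A → ℕ} → (∀ x → f x ≡ g x) → ∑ xs f ≡ ∑ xs g
  ∑-cong xs f≗g = cong sum (map-cong f≗g xs)

  ∑-mono : ∀ (xs : List A) {f g : A → ℕ} → (∀ x → f x ≤ g x) → ∑ xs f ≤ ∑ xs g
  ∑-mono []       f≤g = z≤n
  ∑-mono (x ∷ xs) f≤g = +-mono-≤ (f≤g x) (∑-mono xs f≤g)

  ∑-+ : ∀ (xs : List A) f g → ∑[ x ∈ xs ] (f x + g x) ≡ ∑ xs f + ∑ xs g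
  ∑-+ []       f g = refl
  ∑-+ (x ∷ xs) f g = trans (cong (_+_ (f x + g x)) (∑-+ xs f g)) (+-interchange (f x) (g x) _ _)

  ∑-*ˡ : ∀ (xs : List A) c f → ∑[ x ∈ xs ] (c * f x) ≡ c * ∑ xs f
  ∑-*ˡ []       c f = sym (*-zeroʳ c)
  ∑-*ˡ (x ∷ xs) c f = trans (cong (_+_ (c * f x)) (∑-*ˡ xs c f)) (sym (*-distribˡ-+ c (f x) (∑ xs f)))

  ∑-zero : ∀ (xs : List A) → ∑[ x ∈ xs ] 0 ≡ 0
  ∑-zero []       = refl
  ∑-zero (x ∷ xs) = ∑-zero xs

  length-filter≡∑ : ∀ {p} {P : Pred A p} (P? : Decidable P) xs →
                    length (filter P? xs) ≡ ∑[ x ∈ xs ] b2n (does (P? x))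
  length-filter≡∑ P? []       = refl
  length-filter≡∑ P? (x ∷ xs) with does (P? x)
  ... | true  = cong suc (length-filter≡∑ P? xs)
  ... | false = length-filter≡∑ P? xs

∑-map : ∀ {A B : Set} (g : A → B) (xs : List A) f → ∑ (map g xs) f ≡ ∑ xs (f ∘ g)
∑-map g xs f = cong sum (sym (map-∘ xs))

∑-product : ∀ {A B : Set} (xs : List A) (ys : List B) f g →
            ∑[ x ∈ xs ] ∑[ y ∈ ys ] (f x * g y) ≡ ∑ xs f * ∑ ys g
∑-product xs ys f g = begin
  ∑[ x ∈ xs ] ∑[ y ∈ ys ] (f x * g y)  ≡⟨ ∑-cong xs (λ x → ∑-*ˡ ys (f x) g) ⟩
  ∑[ x ∈ xs ] (f x * ∑ ys g)           ≡⟨ ∑-cong xs (λ x → *-comm (f x) (∑ ys g)) ⟩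
  ∑[ x ∈ xs ] (∑ ys g * f x)           ≡⟨ ∑-*ˡ xs (∑ ys g) f ⟩
  ∑ ys g * ∑ xs f                      ≡⟨ *-comm (∑ ys g) (∑ xs f) ⟩
  ∑ xs f * ∑ ys g                      ∎
  where open ≡-Reasoning

∑-allCube-suc : ∀ m (f : Cube (suc m) → ℕ) →
                ∑ (allCube (suc m)) f ≡ ∑[ x ∈ allCube m ] f (false ∷ x) + ∑[ x ∈ allCube m ] f (true ∷ x)
∑-allCube-suc m f = trans (∑-++ (map (false ∷_) (allCube m)) _ f)
                          (cong₂ _+_ (∑-map (false ∷_) (allCube m) f) (∑-map (true ∷_) (allCube m) f))

∑-allCube-1 : ∀ m → ∑[ x ∈ allCube m ] 1 ≡ 2 ^ m
∑-allCube-1 zero    = refl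
∑-allCube-1 (suc m) = begin
  ∑[ x ∈ allCube (suc m) ] 1  ≡⟨ ∑-allCube-suc m (λ _ → 1) ⟩
  ∑[ x ∈ allCube m ] 1 + ∑[ x ∈ allCube m ] 1  ≡⟨ cong₂ _+_ (∑-allCube-1 m) (∑-allCube-1 m) ⟩
  2 ^ m + 2 ^ m  ≡⟨ cong (_+_ (2 ^ m)) (sym (+-identityʳ (2 ^ m))) ⟩
  2 ^ suc m  ∎
  where open ≡-Reasoning

∑-allCube-+ : ∀ a b (f : Cube (a + b) → ℕ) →
              ∑ (allCube (a + b)) f ≡ ∑[ x ∈ allCube a ] ∑[ y ∈ allCube b ] f (x ++ y)
∑-allCube-+ zero    b f = sym (+-identityʳ _)
∑-allCube-+ (suc a) b f = begin
  ∑ (allCube (suc a + b)) f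
    ≡⟨ ∑-allCube-suc (a + b) f ⟩
  ∑[ z ∈ allCube (a + b) ] f (false ∷ z) + ∑[ z ∈ allCube (a + b) ] f (true ∷ z)
    ≡⟨ cong₂ _+_ (∑-allCube-+ a b (f ∘ (false ∷_))) (∑-allCube-+ a b (f ∘ (true ∷_))) ⟩
  ∑[ x ∈ allCube a ] ∑[ y ∈ allCube b ] f (false ∷ x ++ y)
    + ∑[ x ∈ allCube a ] ∑[ y ∈ allCube b ] f (true ∷ x ++ y)
    ≡⟨ ∑-allCube-suc a (λ x → ∑[ y ∈ allCube b ] f (x ++ y)) ⟨
  ∑[ x ∈ allCube (suc a) ] ∑[ y ∈ allCube b ] f (x ++ y)  ∎
  where open ≡-Reasoning

splitAt-++ : ∀ {A : Set} m {n} (xs : Vec A m) (ys : Vec A n) → splitAt m (xs ++ ys) ≡ (xs , ys , refl)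
splitAt-++ zero    []       ys = refl
splitAt-++ (suc m) (x ∷ xs) ys rewrite splitAt-++ m xs ys = refl

weight-++ : ∀ {a b} (x : Cube a) (y : Cube b) → weight (x ++ y) ≡ weight x + weight y
weight-++ []      y = refl
weight-++ (b ∷ x) y = trans (cong (_+_ (b2n b)) (weight-++ x y)) (sym (+-assoc (b2n b) _ _))

monomial-++ : ∀ {a b} (S : Cube a) (T : Cube b) (x : Cube a) (y : Cube b) →
              monomial (S ++ T) (x ++ y) ≡ monomial S x * monomial T y
monomial-++ []          T []      y = sym (+-identityʳ _)
monomial-++ (false ∷ S) T (_ ∷ x) y = monomial-++ S T x y
monomial-++ (true ∷ S)  T (b ∷ x) y =
  trans (cong (b2n b *_) (monomial-++ S T x y)) (sym (*-assoc (b2n b) _ _))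

elementarySymmetric : ∀ {m} → ℕ → Cube m → ℕ
elementarySymmetric {m} d x = ∑[ S ∈ allCube m ] (b2n (weight S ≡ᵇ d) * monomial S x)

elementarySymmetric-∷ : ∀ {m} d b (x : Cube m) →
  elementarySymmetric d (b ∷ x)
    ≡ elementarySymmetric d x + b2n b * ∑[ S ∈ allCube m ] (b2n (suc (weight S) ≡ᵇ d) * monomial S x)
elementarySymmetric-∷ {m} d b x = trans (∑-allCube-suc m _) (cong (_+_ (elementarySymmetric d x)) (begin
  ∑[ S ∈ allCube m ] (c S * (b2n b * monomial S x))
    ≡⟨ ∑-cong (allCube m) (λ S → *-left-comm (c S) (b2n b) (monomial S x)) ⟩
  ∑[ S ∈ allCube m ] (b2n b * (c S * monomial S x))
    ≡⟨ ∑-*ˡ (allCube m) (b2n b) (λ S → c S * monomial S x) ⟩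
  b2n b * ∑[ S ∈ allCube m ] (c S * monomial S x)  ∎))
  where
  open ≡-Reasoning
  c : Cube m → ℕ
  c S = b2n (suc (weight S) ≡ᵇ d)

pascal-bit : ∀ b w d → (b2n b + w) C suc d ≡ w C suc d + b2n b * (w C d)
pascal-bit false w d = sym (+-identityʳ (w C suc d))
pascal-bit true  w d = begin
  suc w C suc d             ≡⟨ nCk+nC[k+1]≡[n+1]C[k+1] w d ⟨
  w C d + w C suc d         ≡⟨ +-comm (w C d) (w C suc d) ⟩
  w C suc d + w C d         ≡⟨ cong (_+_ (w C suc d)) (sym (*-identityˡ (w C d))) ⟩
  w C suc d + 1 * (w C d)   ∎
  where open ≡-Reasoning

elementarySymmetric≡C : ∀ {m} d (x : Cube m) → elementarySymmetric d x ≡ weight x C d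
elementarySymmetric≡C zero    []      = refl
elementarySymmetric≡C (suc d) []      = refl
elementarySymmetric≡C {suc m} zero (b ∷ x) = begin
  elementarySymmetric 0 (b ∷ x)
    ≡⟨ elementarySymmetric-∷ 0 b x ⟩
  elementarySymmetric 0 x + b2n b * ∑[ S ∈ allCube m ] 0
    ≡⟨ cong₂ (λ e s → e + b2n b * s) (elementarySymmetric≡C 0 x) (∑-zero (allCube m)) ⟩
  1 + b2n b * 0
    ≡⟨ cong suc (*-zeroʳ (b2n b)) ⟩
  1  ∎
  where open ≡-Reasoning
elementarySymmetric≡C (suc d) (b ∷ x) = begin
  elementarySymmetric (suc d) (b ∷ x)
    ≡⟨ elementarySymmetric-∷ (suc d) b x ⟩
  elementarySymmetric (suc d) x + b2n b * elementarySymmetric d x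
    ≡⟨ cong₂ (λ e f → e + b2n b * f) (elementarySymmetric≡C (suc d) x) (elementarySymmetric≡C d x) ⟩
  weight x C suc d + b2n b * (weight x C d)
    ≡⟨ pascal-bit b (weight x) d ⟨
  (b2n b + weight x) C suc d  ∎
  where open ≡-Reasoning

b2n-∧ : ∀ a b → b2n (a ∧ b) ≡ b2n a * b2n b
b2n-∧ true  true  = refl
b2n-∧ true  false = refl
b2n-∧ false b     = refl

module ElementaryProduct (n d : ℕ) where

  bothLayers : Cube (n + n) → Bool
  bothLayers S = let (u , v , _) = splitAt n S in (weight u ≡ᵇ d) ∧ (weight v ≡ᵇ d)

  bothLayers-weight : ∀ S → T (bothLayers S) → weight S ≡ 2 * d
  bothLayers-weight S t with splitAt n S
  ... | u , v , refl = begin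
    weight (u ++ v)     ≡⟨ weight-++ u v ⟩
    weight u + weight v ≡⟨ cong₂ _+_ (≡ᵇ⇒≡ (weight u) d tu) (≡ᵇ⇒≡ (weight v) d tv) ⟩
    d + d               ≡⟨ cong (_+_ d) (sym (+-identityʳ d)) ⟩
    2 * d               ∎
    where
    open ≡-Reasoning
    open Equivalence T-∧ using (to)
    tu = proj₁ (to t)
    tv = proj₂ (to t)

  bothLayers-++ : ∀ u v → bothLayers (u ++ v) ≡ (weight u ≡ᵇ d) ∧ (weight v ≡ᵇ d)
  bothLayers-++ u v rewrite splitAt-++ n u v = refl

  coefficient : Cube (n + n) → Fin (2 ^ 2)
  coefficient S = if bothLayers S then fsuc fzero else fzero

  toℕ-coefficient : ∀ S → toℕ (coefficient S) ≡ b2n (bothLayers S)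
  toℕ-coefficient S with bothLayers S
  ... | true  = refl
  ... | false = refl

  polynomial : Poly (n + n) (2 * d) 2
  polynomial = record { coeff = coefficient ; deg = degree-bound }
    where
    degree-bound : ∀ S → 2 * d < weight S → toℕ (coefficient S) ≡ 0
    degree-bound S 2d<w with bothLayers S in eq
    ... | true  = ⊥-elim (<-irrefl (sym (bothLayers-weight S (subst T (sym eq) _))) 2d<w)
    ... | false = refl

  eval-++ : ∀ (x y : Cube n) → eval polynomial (x ++ y) ≡ ((weight x C d) * (weight y C d)) % 4
  eval-++ x y = cong (_% 4) (begin
    ∑[ S ∈ allCube (n + n) ] (toℕ (coefficient S) * monomial S (x ++ y))
      ≡⟨ ∑-allCube-+ n n _ ⟩
    ∑[ u ∈ allCube n ] ∑[ v ∈ allCube n ] (toℕ (coefficient (u ++ v)) * monomial (u ++ v) (x ++ y))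
      ≡⟨ ∑-cong (allCube n) (λ u → ∑-cong (allCube n) (term u)) ⟩
    ∑[ u ∈ allCube n ] ∑[ v ∈ allCube n ] (layer u x * layer v y)
      ≡⟨ ∑-product (allCube n) (allCube n) (λ u → layer u x) (λ v → layer v y) ⟩
    elementarySymmetric d x * elementarySymmetric d y
      ≡⟨ cong₂ _*_ (elementarySymmetric≡C d x) (elementarySymmetric≡C d y) ⟩
    (weight x C d) * (weight y C d)  ∎)
    where
    open ≡-Reasoning
    layer : Cube n → Cube n → ℕ
    layer u x = b2n (weight u ≡ᵇ d) * monomial u x
    term : ∀ u v → toℕ (coefficient (u ++ v)) * monomial (u ++ v) (x ++ y) ≡ layer u x * layer v y
    term u v = begin
      toℕ (coefficient (u ++ v)) * monomial (u ++ v) (x ++ y)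
        ≡⟨ cong₂ _*_ (toℕ-coefficient (u ++ v)) (monomial-++ u v x y) ⟩
      b2n (bothLayers (u ++ v)) * (monomial u x * monomial v y)
        ≡⟨ cong (λ b → b2n b * (monomial u x * monomial v y)) (bothLayers-++ u v) ⟩
      b2n ((weight u ≡ᵇ d) ∧ (weight v ≡ᵇ d)) * (monomial u x * monomial v y)
        ≡⟨ cong (_* (monomial u x * monomial v y)) (b2n-∧ (weight u ≡ᵇ d) (weight v ≡ᵇ d)) ⟩
      (b2n (weight u ≡ᵇ d) * b2n (weight v ≡ᵇ d)) * (monomial u x * monomial v y)
        ≡⟨ *-interchange (b2n (weight u ≡ᵇ d)) _ _ _ ⟩
      layer u x * layer v y  ∎

infix 4 _≡₂_

-- A record rather than a definition, so that unification sees a and b instead of unfolded _%_.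
record _≡₂_ (a b : ℕ) : Set where
  constructor mod₂
  field %2-≡ : a % 2 ≡ b % 2

open _≡₂_

≡₂-setoid : Setoid 0ℓ 0ℓ
≡₂-setoid = record
  { _≈_           = _≡₂_
  ; isEquivalence = record
    { refl  = mod₂ refl
    ; sym   = λ (mod₂ a≡b) → mod₂ (sym a≡b)
    ; trans = λ (mod₂ a≡b) (mod₂ b≡c) → mod₂ (trans a≡b b≡c)
    }
  }

≡₂-+ : ∀ {a a′ b b′} → a ≡₂ a′ → b ≡₂ b′ → a + b ≡₂ a′ + b′
≡₂-+ {a} {a′} {b} {b′} (mod₂ a≡a′) (mod₂ b≡b′) = mod₂ (begin
  (a + b) % 2              ≡⟨ %-distribˡ-+ a b 2 ⟩
  (a % 2 + b % 2) % 2      ≡⟨ cong₂ (λ p q → (p + q) % 2) a≡a′ b≡b′ ⟩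
  (a′ % 2 + b′ % 2) % 2    ≡⟨ %-distribˡ-+ a′ b′ 2 ⟨
  (a′ + b′) % 2            ∎)
  where open ≡-Reasoning

+-double-≡₂ : ∀ a b → a + b + b ≡₂ a
+-double-≡₂ a b = mod₂ (trans (cong (_% 2) (+-double a b)) ([m+kn]%n≡m%n a b 2))
  where
  +-double : ∀ a b → a + b + b ≡ a + b * 2
  +-double = solve-∀

-- The coefficient of X^(i+D) in (1 + X)^(w+D) ≡ (1 + X)^w (1 + X^D) (mod 2).
Frobenius₂ : ℕ → Set
Frobenius₂ D = ∀ w i → (w + D) C (i + D) ≡₂ w C (i + D) + w C i

frobenius₂-1 : Frobenius₂ 1
frobenius₂-1 w i rewrite +-comm w 1 | +-comm i 1 =
  mod₂ (cong (_% 2) (trans (sym (nCk+nC[k+1]≡[n+1]C[k+1] w i)) (+-comm (w C i) (w C suc i))))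

frobenius₂-double : ∀ {D} → Frobenius₂ D → Frobenius₂ (D + D)
frobenius₂-double {D} frob w i = begin
  (w + (D + D)) C (i + (D + D))
    ≡⟨ cong₂ _C_ (sym (+-assoc w D D)) (sym (+-assoc i D D)) ⟩
  (w + D + D) C (i + D + D)
    ≈⟨ frob (w + D) (i + D) ⟩
  (w + D) C (i + D + D) + (w + D) C (i + D)
    ≈⟨ ≡₂-+ (frob w (i + D)) (frob w i) ⟩
  w C (i + D + D) + w C (i + D) + (w C (i + D) + w C i)
    ≡⟨ +-assoc (w C (i + D + D) + w C (i + D)) (w C (i + D)) (w C i) ⟨
  w C (i + D + D) + w C (i + D) + w C (i + D) + w C i
    ≈⟨ ≡₂-+ (+-double-≡₂ (w C (i + D + D)) (w C (i + D))) (mod₂ refl) ⟩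
  w C (i + D + D) + w C i
    ≡⟨ cong (λ b → w C b + w C i) (+-assoc i D D) ⟩
  w C (i + (D + D)) + w C i  ∎
  where open SetoidReasoning ≡₂-setoid

frobenius₂-2^ : ∀ j → Frobenius₂ (2 ^ j)
frobenius₂-2^ zero    = frobenius₂-1
frobenius₂-2^ (suc j) = subst Frobenius₂ (cong (_+_ (2 ^ j)) (sym (+-identityʳ (2 ^ j))))
                              (frobenius₂-double (frobenius₂-2^ j))

[1+a]%2+a%2≡1 : ∀ a → suc a % 2 + a % 2 ≡ 1
[1+a]%2+a%2≡1 zero          = refl
[1+a]%2+a%2≡1 (suc zero)    = refl
[1+a]%2+a%2≡1 (suc (suc a)) = [1+a]%2+a%2≡1 a

C-2^-antiperiodic : ∀ j w → ((w + 2 ^ j) C 2 ^ j) % 2 + (w C 2 ^ j) % 2 ≡ 1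
C-2^-antiperiodic j w = begin
  ((w + 2 ^ j) C 2 ^ j) % 2 + (w C 2 ^ j) % 2   ≡⟨ cong (_+ (w C 2 ^ j) % 2) (%2-≡ (frobenius₂-2^ j w 0)) ⟩
  (w C 2 ^ j + 1) % 2 + (w C 2 ^ j) % 2         ≡⟨ cong (λ a → a % 2 + (w C 2 ^ j) % 2) (+-comm (w C 2 ^ j) 1) ⟩
  suc (w C 2 ^ j) % 2 + (w C 2 ^ j) % 2         ≡⟨ [1+a]%2+a%2≡1 (w C 2 ^ j) ⟩
  1                                             ∎
  where open ≡-Reasoning

-- Only the points 0…0 and 1…1 contribute f 0 and f (suc m) exactly; each of the other
-- 2^(suc m) - 2 points contributes at most B/2 (doubled, and 2B moved left, to avoid halving
-- and truncated subtraction).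
∑-weight-bound : ∀ (f : ℕ → ℕ) B → (∀ w → 2 * f w ≤ B) → ∀ m →
  2 * ∑[ u ∈ allCube (suc m) ] f (weight u) + 2 * B ≤ 2 * (f 0 + f (suc m)) + 2 ^ suc m * B
∑-weight-bound f B 2f≤B zero    = ≤-reflexive (base (f 0) (f 1) B)
  where base : ∀ a b B → 2 * (a + (b + 0)) + 2 * B ≡ 2 * (a + b) + 2 ^ 1 * B
        base = solve-∀
∑-weight-bound f B 2f≤B (suc m) = +-cancelʳ-≤ (2 * B) _ _ (begin
  2 * ∑[ u ∈ allCube (suc (suc m)) ] f (weight u) + 2 * B + 2 * B
    ≡⟨ cong (λ s → 2 * s + 2 * B + 2 * B) (∑-allCube-suc (suc m) (f ∘ weight)) ⟩
  2 * (S + S′) + 2 * B + 2 * B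
    ≡⟨ split S S′ B ⟩
  (2 * S + 2 * B) + (2 * S′ + 2 * B)
    ≤⟨ +-mono-≤ (∑-weight-bound f B 2f≤B m) (∑-weight-bound (f ∘ suc) B (2f≤B ∘ suc) m) ⟩
  (2 * (f 0 + f (suc m)) + P) + (2 * (f 1 + f (suc (suc m))) + P)
    ≡⟨ regroup (f 0) (f (suc m)) (f 1) (f (suc (suc m))) P ⟩
  2 * (f 0 + f (suc (suc m))) + (2 * f (suc m) + 2 * f 1) + 2 * P
    ≤⟨ +-monoˡ-≤ (2 * P) (+-monoʳ-≤ (2 * (f 0 + f (suc (suc m)))) (+-mono-≤ (2f≤B (suc m)) (2f≤B 1))) ⟩
  2 * (f 0 + f (suc (suc m))) + (B + B) + 2 * P
    ≡⟨ collect (2 * (f 0 + f (suc (suc m)))) (2 ^ suc m) B ⟩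
  2 * (f 0 + f (suc (suc m))) + 2 ^ suc (suc m) * B + 2 * B  ∎)
  where
  open ≤-Reasoning
  S  = ∑[ u ∈ allCube (suc m) ] f (weight u)
  S′ = ∑[ u ∈ allCube (suc m) ] f (suc (weight u))
  P  = 2 ^ suc m * B
  split : ∀ S S′ B → 2 * (S + S′) + 2 * B + 2 * B ≡ (2 * S + 2 * B) + (2 * S′ + 2 * B)
  split = solve-∀
  regroup : ∀ a b c e P → (2 * (a + b) + P) + (2 * (c + e) + P) ≡ 2 * (a + e) + (2 * b + 2 * c) + 2 * P
  regroup = solve-∀
  collect : ∀ a X B → a + (B + B) + 2 * (X * B) ≡ a + (2 * X) * B + 2 * B
  collect = solve-∀

bernoulli : ∀ c k → c ^ k * (c + 2 * k) ≤ c * (c + 2) ^ k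
bernoulli c zero    = ≤-reflexive (base c)
  where base : ∀ c → 1 * (c + 2 * 0) ≡ c * 1
        base = solve-∀
bernoulli c (suc k) = begin
  c * c ^ k * (c + 2 * suc k)                        ≡⟨ expand c (c ^ k) k ⟩
  c ^ k * (c + 2 * k) * c + c ^ k * (2 * c)
    ≤⟨ +-monoʳ-≤ (c ^ k * (c + 2 * k) * c) (*-monoʳ-≤ (c ^ k) (*-monoʳ-≤ 2 (m≤m+n c (2 * k)))) ⟩
  c ^ k * (c + 2 * k) * c + c ^ k * (2 * (c + 2 * k)) ≡⟨ factor c (c ^ k) (c + 2 * k) ⟩
  (c + 2) * (c ^ k * (c + 2 * k))                    ≤⟨ *-monoʳ-≤ (c + 2) (bernoulli c k) ⟩
  (c + 2) * (c * (c + 2) ^ k)                        ≡⟨ *-left-comm (c + 2) c ((c + 2) ^ k) ⟩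
  c * (c + 2) ^ suc k                                ∎
  where
  open ≤-Reasoning
  expand : ∀ c p k → c * p * (c + 2 * suc k) ≡ p * (c + 2 * k) * c + p * (2 * c)
  expand = solve-∀
  factor : ∀ c p z → p * z * c + p * (2 * z) ≡ (c + 2) * (p * z)
  factor = solve-∀

K*c^k≤[c+2]^k : ∀ c K k → K * c ≤ 2 * k → 1 ≤ k → K * c ^ k ≤ (c + 2) ^ k
K*c^k≤[c+2]^k zero      K (suc k) _     _ = ≤-trans (≤-reflexive (*-zeroʳ K)) z≤n
K*c^k≤[c+2]^k c@(suc _) K k       Kc≤2k _ = *-cancelˡ-≤ c (begin
  c * (K * c ^ k)          ≡⟨ rotate c K (c ^ k) ⟩
  c ^ k * (K * c)          ≤⟨ *-monoʳ-≤ (c ^ k) (≤-trans Kc≤2k (m≤n+m (2 * k) c)) ⟩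
  c ^ k * (c + 2 * k)      ≤⟨ bernoulli c k ⟩
  c * (c + 2) ^ k          ∎)
  where
  open ≤-Reasoning
  rotate : ∀ c K p → c * (K * p) ≡ p * (K * c)
  rotate = solve-∀

module AntiperiodicCount (q : ℕ → ℕ) (q≤1 : ∀ w → q w ≤ 1) (D-1 : ℕ)
                         (q-antiperiodic : ∀ w → q (w + suc D-1) + q w ≡ 1) where

  D : ℕ
  D = suc D-1

  count : ℕ → ℕ → ℕ
  count m t = ∑[ v ∈ allCube m ] q (weight v + t)

  count≤2^ : ∀ m t → count m t ≤ 2 ^ m
  count≤2^ m t = ≤-trans (∑-mono (allCube m) (λ v → q≤1 (weight v + t))) (≤-reflexive (∑-allCube-1 m))

  count-complement : ∀ m t → count m t + count m (D + t) ≡ 2 ^ m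
  count-complement m t = begin
    count m t + count m (D + t)                         ≡⟨ ∑-+ (allCube m) _ _ ⟨
    ∑[ v ∈ allCube m ] (q (weight v + t) + q (weight v + (D + t)))
      ≡⟨ ∑-cong (allCube m) (λ v → complement (weight v + t) (weight v + (D + t)) (shift (weight v))) ⟩
    ∑[ v ∈ allCube m ] 1                                ≡⟨ ∑-allCube-1 m ⟩
    2 ^ m                                               ∎
    where
    open ≡-Reasoning
    shift : ∀ w → w + (D + t) ≡ w + t + D
    shift w = trans (cong (_+_ w) (+-comm D t)) (sym (+-assoc w t D))
    complement : ∀ w w′ → w′ ≡ w + D → q w + q w′ ≡ 1
    complement w _ refl = trans (+-comm (q w) _) (q-antiperiodic w)

  count-+ : ∀ m t → count (D + m) t ≡ ∑[ u ∈ allCube D ] count m (weight u + t)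
  count-+ m t = trans (∑-allCube-+ D m _)
    (∑-cong (allCube D) λ u → ∑-cong (allCube m) λ v → cong q (begin
      weight (u ++ v) + t          ≡⟨ cong (_+ t) (weight-++ u v) ⟩
      weight u + weight v + t      ≡⟨ rearrange (weight u) (weight v) t ⟩
      weight v + (weight u + t)    ∎))
    where
    open ≡-Reasoning
    rearrange : ∀ a b e → a + b + e ≡ b + (a + e)
    rearrange = solve-∀

  c : ℕ
  c = 2 ^ D ∸ 2

  c+2≡2^D : c + 2 ≡ 2 ^ D
  c+2≡2^D = m∸n+n≡m (^-monoʳ-≤ 2 {1} {D} (s≤s z≤n))

  -- Splitting off D coordinates, the two extreme subcubes together contribute exactly 2^m by
  -- antiperiodicity, so the excess U over half the cube is multiplied by c = 2^D - 2, not 2^D.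
  count-contract : ∀ m U → (∀ t → 2 * count m t ≤ 2 ^ m + U) →
                   ∀ t → 2 * count (D + m) t ≤ 2 ^ (D + m) + c * U
  count-contract m U bound t = +-cancelʳ-≤ (2 * B) _ _ (begin
    2 * count (D + m) t + 2 * B
      ≡⟨ cong (λ s → 2 * s + 2 * B) (count-+ m t) ⟩
    2 * ∑[ u ∈ allCube D ] count m (weight u + t) + 2 * B
      ≤⟨ ∑-weight-bound (λ w → count m (w + t)) B (λ w → bound (w + t)) D-1 ⟩
    2 * (count m t + count m (D + t)) + 2 ^ D * B
      ≡⟨ cong₂ (λ a b → 2 * a + b * B) (count-complement m t) (sym c+2≡2^D) ⟩
    2 * 2 ^ m + (c + 2) * B
      ≡⟨ regroup (2 ^ m) U c ⟩
    (c + 2) * 2 ^ m + c * U + 2 * B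
      ≡⟨ cong (λ a → a * 2 ^ m + c * U + 2 * B) c+2≡2^D ⟩
    2 ^ D * 2 ^ m + c * U + 2 * B
      ≡⟨ cong (λ a → a + c * U + 2 * B) (^-distribˡ-+-* 2 D m) ⟨
    2 ^ (D + m) + c * U + 2 * B  ∎)
    where
    open ≤-Reasoning
    B = 2 ^ m + U
    regroup : ∀ P U c → 2 * P + (c + 2) * (P + U) ≡ (c + 2) * P + c * U + 2 * (P + U)
    regroup = solve-∀

  count-bound : ∀ k r t → 2 * count (k * D + r) t ≤ 2 ^ (k * D + r) + c ^ k * 2 ^ r
  count-bound zero    r t = begin
    2 * count r t          ≤⟨ *-monoʳ-≤ 2 (count≤2^ r t) ⟩
    2 * 2 ^ r              ≡⟨ cong (_+_ (2 ^ r)) (trans (+-identityʳ (2 ^ r)) (sym (*-identityˡ (2 ^ r)))) ⟩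
    2 ^ r + 1 * 2 ^ r      ∎
    where open ≤-Reasoning
  count-bound (suc k) r t = begin
    2 * count (D + k * D + r) t              ≡⟨ cong (λ n → 2 * count n t) (+-assoc D (k * D) r) ⟩
    2 * count (D + (k * D + r)) t            ≤⟨ count-contract (k * D + r) (c ^ k * 2 ^ r) (count-bound k r) t ⟩
    2 ^ (D + (k * D + r)) + c * (c ^ k * 2 ^ r)
      ≡⟨ cong₂ (λ n e → 2 ^ n + e) (sym (+-assoc D (k * D) r)) (sym (*-assoc c (c ^ k) (2 ^ r))) ⟩
    2 ^ (D + k * D + r) + c * c ^ k * 2 ^ r  ∎
    where open ≤-Reasoning

  count-eventually : ∀ K → ∃[ N₀ ] (∀ n → N₀ ≤ n → ∃[ e ] (2 * count n 0 ≤ 2 ^ n + e × K * e ≤ 2 ^ n))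
  count-eventually K = (K * c + 1) * D , λ n N₀≤n → c ^ (n ℕ./ D) * 2 ^ (n % D) , bound n , small n N₀≤n
    where
    division : ∀ n → n ℕ./ D * D + n % D ≡ n
    division n = trans (+-comm (n ℕ./ D * D) (n % D)) (sym (m≡m%n+[m/n]*n n D))

    bound : ∀ n → 2 * count n 0 ≤ 2 ^ n + c ^ (n ℕ./ D) * 2 ^ (n % D)
    bound n = subst (λ m → 2 * count m 0 ≤ 2 ^ m + c ^ (n ℕ./ D) * 2 ^ (n % D)) (division n)
                    (count-bound (n ℕ./ D) (n % D) 0)

    small : ∀ n → (K * c + 1) * D ≤ n → K * (c ^ (n ℕ./ D) * 2 ^ (n % D)) ≤ 2 ^ n
    small n N₀≤n = begin
      K * (c ^ k * 2 ^ r)            ≡⟨ *-assoc K (c ^ k) (2 ^ r) ⟨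
      K * c ^ k * 2 ^ r              ≤⟨ *-monoˡ-≤ (2 ^ r) (K*c^k≤[c+2]^k c K k Kc≤2k 1≤k) ⟩
      (c + 2) ^ k * 2 ^ r            ≡⟨ cong (λ a → a ^ k * 2 ^ r) c+2≡2^D ⟩
      (2 ^ D) ^ k * 2 ^ r            ≡⟨ cong (_* 2 ^ r) (trans (^-*-assoc 2 D k) (cong (2 ^_) (*-comm D k))) ⟩
      2 ^ (k * D) * 2 ^ r            ≡⟨ ^-distribˡ-+-* 2 (k * D) r ⟨
      2 ^ (k * D + r)                ≡⟨ cong (2 ^_) (division n) ⟩
      2 ^ n                          ∎
      where
      open ≤-Reasoning
      k = n ℕ./ D
      r = n % D
      Kc+1≤k : K * c + 1 ≤ k
      Kc+1≤k = ≤-trans (≤-reflexive (sym (m*n/n≡m (K * c + 1) D))) (/-monoˡ-≤ D N₀≤n)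
      1≤k : 1 ≤ k
      1≤k = ≤-trans (m≤n+m 1 (K * c)) Kc+1≤k
      Kc≤2k : K * c ≤ 2 * k
      Kc≤2k = ≤-trans (m≤m+n (K * c) 1) (≤-trans Kc+1≤k (m≤n*m k 2))

oddBinomialCount : ℕ → ℕ → ℕ
oddBinomialCount d n = ∑[ x ∈ allCube n ] ((weight x C d) % 2)

oddBinomialCount-eventually : ∀ j K → ∃[ N₀ ] (∀ n → N₀ ≤ n →
  ∃[ e ] (2 * oddBinomialCount (2 ^ j) n ≤ 2 ^ n + e × K * e ≤ 2 ^ n))
oddBinomialCount-eventually j K = N₀ , λ n N₀≤n → let (e , bound , small) = eventually n N₀≤n in
  e , subst (λ N → 2 * N ≤ 2 ^ n + e) (∑-cong (allCube n) (λ x → cong q (+-identityʳ (weight x)))) bound , small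
  where
  q : ℕ → ℕ
  q w = (w C 2 ^ j) % 2
  antiperiodic : ∀ w → q (w + suc (pred (2 ^ j))) + q w ≡ 1
  antiperiodic w = subst (λ D → q (w + D) + q w ≡ 1) (sym (suc-pred (2 ^ j) {{m^n≢0 2 j}})) (C-2^-antiperiodic j w)
  open AntiperiodicCount q (λ w → ≤-pred (m%n<n (w C 2 ^ j) 2)) (pred (2 ^ j)) antiperiodic
  N₀ = proj₁ (count-eventually K)
  eventually = proj₂ (count-eventually K)

three-quarters-arith : ∀ K .{{_ : NonZero K}} A X N e → A * A ≤ X + N * N → 2 * N ≤ A + e → K * e ≤ A →
                       3 * (A * A * K) ≤ (X * K + A * A) * 4
three-quarters-arith K A X N e A²≤X+N² 2N≤A+e Ke≤A = +-cancelʳ-≤ (K * (A * A)) _ _ (begin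
  3 * (A * A * K) + K * (A * A)               ≡⟨ r₁ K A ⟩
  K * (4 * (A * A))                           ≤⟨ *-monoʳ-≤ K 4A²≤4X+A²+3Ae ⟩
  K * (4 * X + (A * A + 3 * A * e))           ≡⟨ r₂ K A X e ⟩
  4 * K * X + K * (A * A) + 3 * A * (K * e)   ≤⟨ +-monoʳ-≤ (4 * K * X + K * (A * A)) (*-monoʳ-≤ (3 * A) Ke≤A) ⟩
  4 * K * X + K * (A * A) + 3 * A * A         ≤⟨ +-monoʳ-≤ (4 * K * X + K * (A * A)) (m≤m+n (3 * A * A) (A * A)) ⟩
  4 * K * X + K * (A * A) + (3 * A * A + A * A) ≡⟨ r₃ K A X ⟩
  (X * K + A * A) * 4 + K * (A * A)           ∎)
  where
  open ≤-Reasoning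
  e≤A : e ≤ A
  e≤A = ≤-trans (m≤n*m e K) Ke≤A
  4A²≤4X+A²+3Ae : 4 * (A * A) ≤ 4 * X + (A * A + 3 * A * e)
  4A²≤4X+A²+3Ae = begin
    4 * (A * A)                         ≤⟨ *-monoʳ-≤ 4 A²≤X+N² ⟩
    4 * (X + N * N)                     ≡⟨ s₁ X N ⟩
    4 * X + (2 * N) * (2 * N)           ≤⟨ +-monoʳ-≤ (4 * X) (*-mono-≤ 2N≤A+e 2N≤A+e) ⟩
    4 * X + (A + e) * (A + e)           ≡⟨ s₂ X A e ⟩
    4 * X + (A * A + 2 * A * e + e * e) ≤⟨ +-monoʳ-≤ (4 * X) (+-monoʳ-≤ (A * A + 2 * A * e) (*-monoˡ-≤ e e≤A)) ⟩
    4 * X + (A * A + 2 * A * e + A * e) ≡⟨ s₃ X A e ⟩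
    4 * X + (A * A + 3 * A * e)         ∎
    where
    s₁ : ∀ X N → 4 * (X + N * N) ≡ 4 * X + (2 * N) * (2 * N)
    s₁ = solve-∀
    s₂ : ∀ X A e → 4 * X + (A + e) * (A + e) ≡ 4 * X + (A * A + 2 * A * e + e * e)
    s₂ = solve-∀
    s₃ : ∀ X A e → 4 * X + (A * A + 2 * A * e + A * e) ≡ 4 * X + (A * A + 3 * A * e)
    s₃ = solve-∀
  r₁ : ∀ K A → 3 * (A * A * K) + K * (A * A) ≡ K * (4 * (A * A))
  r₁ = solve-∀
  r₂ : ∀ K A X e → K * (4 * X + (A * A + 3 * A * e)) ≡ 4 * K * X + K * (A * A) + 3 * A * (K * e)
  r₂ = solve-∀
  r₃ : ∀ K A X → 4 * K * X + K * (A * A) + (3 * A * A + A * A) ≡ (X * K + A * A) * 4 + K * (A * A)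
  r₃ = solve-∀

%2-* : ∀ a b → (a * b) % 2 ≡ (a % 2) * (b % 2)
%2-* a b = trans (%-distribˡ-* a b 2) (m<n⇒m%n≡m (s≤s (*-mono-≤ (bit a) (bit b))))
  where bit : ∀ a → a % 2 ≤ 1
        bit a = ≤-pred (m%n<n a 2)

%4-%2 : ∀ a {k} → a % 4 ≡ k → k % 2 ≡ a % 2
%4-%2 a a%4≡k = trans (cong (_% 2) (sym a%4≡k)) (m∣n⇒o%n%m≡o%m 2 4 a (divides 2 refl))

module Agreement (n d : ℕ) (H : Cube (n + n) → Bool) where
  open ElementaryProduct n d public

  β : Cube n → ℕ
  β x = weight x C d

  F : Cube (n + n) → Bool
  F = FH n d H

  lift-F-++ : ∀ x y → (β x * β y) % 2 ≡ 0 →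
              lift 2 F (x ++ y) ≡ (β x * β y) % 4
  lift-F-++ x y even rewrite splitAt-++ n x y with (β x * β y) % 4 in r
  ... | 0 = refl
  ... | 1 = contradiction (trans (%4-%2 (β x * β y) r) even) λ ()
  ... | 2 = refl
  ... | 3 = contradiction (trans (%4-%2 (β x * β y) r) even) λ ()
  ... | suc (suc (suc (suc _))) = contradiction (subst (_< 4) r (m%n<n (β x * β y) 4)) λ { (s≤s (s≤s (s≤s (s≤s ())))) }

  agreeAt : Cube (n + n) → ℕ
  agreeAt z = b2n (does (lift 2 F z ≟ eval polynomial z))

  agrees-or-odd : ∀ x y → 1 ≤ agreeAt (x ++ y) + (β x * β y) % 2
  agrees-or-odd x y with (β x * β y) % 2 in parity
  ... | suc _ = m≤n⇒m≤o+n _ (s≤s z≤n)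
  ... | zero rewrite dec-true (lift 2 F (x ++ y) ≟ eval polynomial (x ++ y))
                             (trans (lift-F-++ x y parity) (sym (eval-++ x y))) = s≤s z≤n

  ∑-odd : ∑[ x ∈ allCube n ] ∑[ y ∈ allCube n ] ((β x * β y) % 2) ≡ oddBinomialCount d n * oddBinomialCount d n
  ∑-odd = trans (∑-cong (allCube n) (λ x → ∑-cong (allCube n) (λ y → %2-* (β x) (β y))))
                (∑-product (allCube n) (allCube n) (λ x → β x % 2) (λ y → β y % 2))

  agreeCount-bound : 2 ^ (n + n) ≤ agreeCount F polynomial + oddBinomialCount d n * oddBinomialCount d n
  agreeCount-bound = begin
    2 ^ (n + n)                                              ≡⟨ ∑-allCube-1 (n + n) ⟨
    ∑[ z ∈ allCube (n + n) ] 1                               ≡⟨ ∑-allCube-+ n n (λ _ → 1) ⟩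
    ∑[ x ∈ allCube n ] ∑[ y ∈ allCube n ] 1
      ≤⟨ ∑-mono (allCube n) (λ x → ∑-mono (allCube n) (agrees-or-odd x)) ⟩
    ∑[ x ∈ allCube n ] ∑[ y ∈ allCube n ] (agreeAt (x ++ y) + (β x * β y) % 2)
      ≡⟨ ∑-cong (allCube n) (λ x → ∑-+ (allCube n) (λ y → agreeAt (x ++ y)) (λ y → (β x * β y) % 2)) ⟩
    ∑[ x ∈ allCube n ] (∑[ y ∈ allCube n ] agreeAt (x ++ y) + ∑[ y ∈ allCube n ] ((β x * β y) % 2))
      ≡⟨ ∑-+ (allCube n) _ _ ⟩
    ∑[ x ∈ allCube n ] ∑[ y ∈ allCube n ] agreeAt (x ++ y)
      + ∑[ x ∈ allCube n ] ∑[ y ∈ allCube n ] ((β x * β y) % 2)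
      ≡⟨ cong₂ _+_ (sym (∑-allCube-+ n n agreeAt)) ∑-odd ⟩
    ∑ (allCube (n + n)) agreeAt + oddBinomialCount d n * oddBinomialCount d n
      ≡⟨ cong (_+ _) (length-filter≡∑ (λ z → lift 2 F z ≟ eval polynomial z) (allCube (n + n))) ⟨
    agreeCount F polynomial + oddBinomialCount d n * oddBinomialCount d n  ∎
    where open ≤-Reasoning

  agreeCount-three-quarters : ∀ K .{{_ : NonZero K}} e →
    2 * oddBinomialCount d n ≤ 2 ^ n + e → K * e ≤ 2 ^ n →
    3 * (2 ^ (n + n) * K) ≤ (agreeCount F polynomial * K + 2 ^ (n + n)) * 4
  agreeCount-three-quarters K e half small =
    subst (λ B → 3 * (B * K) ≤ (agreeCount F polynomial * K + B) * 4) (sym (^-distribˡ-+-* 2 n n))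
          (three-quarters-arith K (2 ^ n) (agreeCount F polynomial) (oddBinomialCount d n) e
             (subst (_≤ agreeCount F polynomial + oddBinomialCount d n * oddBinomialCount d n)
                    (^-distribˡ-+-* 2 n n) agreeCount-bound)
             half small)

p≤q+r⇒p-r≤q : ∀ {p q} r → p ≤ℚ q ℚ.+ r → p - r ≤ℚ q
p≤q+r⇒p-r≤q {p} {q} r p≤q+r = begin
  p - r              ≤⟨ ℚ.+-monoˡ-≤ (ℚ.- r) p≤q+r ⟩
  q ℚ.+ r - r        ≡⟨ ℚ.+-assoc q r (ℚ.- r) ⟩
  q ℚ.+ (r - r)      ≡⟨ cong (q ℚ.+_) (ℚ.+-inverseʳ r) ⟩
  q ℚ.+ 0ℚ           ≡⟨ ℚ.+-identityʳ q ⟩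
  q                  ∎
  where open ℚ.≤-Reasoning

3/4≤X/B+ε : ∀ X B .{{_ : NonZero B}} p q-1 .(c : Coprime (suc p) (suc q-1)) →
            3 * (B * suc q-1) ≤ (X * suc q-1 + B) * 4 →
            + 3 / 4 ≤ℚ + X / B ℚ.+ mkℚ +[1+ p ] q-1 c
3/4≤X/B+ε X B@(suc B-1) p q-1 c 3BQ≤[XQ+B]4 =
  ℚ.toℚᵘ-cancel-≤ (ℚᵘ.≤-respʳ-≃ (ℚᵘ.≃-sym toℚᵘ-rhs)
    (*≤* (subst₂ ℤ._≤_ lhs-eq rhs-eq (ℤ.+≤+ 3BQ≤[XQ+PB]4))))
  where
  Q = suc q-1
  P = suc p
  3BQ≤[XQ+PB]4 : 3 * (B * Q) ≤ (X * Q + P * B) * 4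
  3BQ≤[XQ+PB]4 = ≤-trans 3BQ≤[XQ+B]4 (*-monoˡ-≤ 4 (+-monoʳ-≤ (X * Q) (m≤n*m B P)))
  toℚᵘ-rhs : toℚᵘ (+ X / B ℚ.+ mkℚ +[1+ p ] q-1 c) ℚᵘ.≃ mkℚᵘ (+ X) B-1 ℚᵘ.+ mkℚᵘ +[1+ p ] q-1
  toℚᵘ-rhs = ℚᵘ.≃-trans (ℚ.toℚᵘ-homo-+ (+ X / B) (mkℚ +[1+ p ] q-1 c))
                        (ℚᵘ.+-congˡ (mkℚᵘ +[1+ p ] q-1) (ℚ.toℚᵘ-fromℚᵘ (mkℚᵘ (+ X) B-1)))
  lhs-eq : + (3 * (B * Q)) ≡ + 3 ℤ.* + (B * Q)
  lhs-eq = ℤ.pos-* 3 (B * Q)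
  rhs-eq : + ((X * Q + P * B) * 4) ≡ (+ X ℤ.* + Q ℤ.+ + P ℤ.* + B) ℤ.* + 4
  rhs-eq = trans (ℤ.pos-* (X * Q + P * B) 4)
                 (cong (ℤ._* + 4) (trans (ℤ.pos-+ (X * Q) (P * B)) (cong₂ ℤ._+_ (ℤ.pos-* X Q) (ℤ.pos-* P B))))

lemma3p6 : (j : ℕ) → (ε : ℚ) → ε > 0ℚ →
    ∃[ N ] ((n : ℕ) → N ≤ n → (H : Cube (n + n) → Bool) →
      ∃[ Q ] ((+ 3 / 4) - ε ≤ℚ agr {n + n} {2 * (2 ^ j)} {2} (FH n (2 ^ j) H) Q))
lemma3p6 j (mkℚ (+ 0)      _   _) (*<* (ℤ.+<+ ()))
lemma3p6 j (mkℚ -[1+ _ ]   _   _) (*<* ())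
lemma3p6 j (mkℚ +[1+ p ]   q-1 c) _ = N₀ , λ n N₀≤n H →
  let open Agreement n (2 ^ j) H
      (e , half , small) = eventually n N₀≤n
  in  polynomial ,
      p≤q+r⇒p-r≤q (mkℚ +[1+ p ] q-1 c)
        (3/4≤X/B+ε (agreeCount F polynomial) (2 ^ (n + n)) {{m^n≢0 2 (n + n)}} p q-1 c
           (agreeCount-three-quarters (suc q-1) e half small))
  where
  N₀ = proj₁ (oddBinomialCount-eventually j (suc q-1))
  eventually = proj₂ (oddBinomialCount-eventually j (suc q-1))
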